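{- Let $n\geq 7$ and $m=\binom{n}{2}-k$ with $2\leq k\leq n/2$. Then there does not exist a least-optimal graph in $\mathcal{G}_{n,m}$.
   Context: All graphs are finite and simple. A set $S$ of vertices of a graph $G$ is dominating if every vertex of $G$ is in $S$ or adjacent to a vertex of $S$. The domination polynomial is $D(G,x)=\sum_{i=1}^{|V(G)|} d(G,i)x^i$, where $d(G,i)$ is the number of dominating sets of $G$ of cardinality $i$. $\mathcal{G}_{n,m}$ denotes the set of simple graphs with $n$ vertices and $m$ edges. A graph $H\in\mathcal{G}_{n,m}$ is least-optimal if $D(H,x)\leq D(G,x)$ for all $G\in\mathcal{G}_{n,m}$ and all $x\geq 0$. -}

module Defs where

open import Data.Bool using (Bool; true; false; _∧_; _∨_; if_then_else_)
open import Data.Nat as ℕ using (ℕ; zero; suc; _≡ᵇ_; _<ᵇ_)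
open import Data.Fin using (Fin; toℕ)
open import Data.Fin.Subset using (Subset; ∣_∣; outside; inside)
open import Data.Vec using (Vec; []; _∷_; lookup)
open import Data.List using (List; []; _∷_; map; _++_; filter; length; allFin; upTo)
open import Data.List.Base using (foldr)
import Data.List as L
open import Data.Nat.ListAction using (sum)
open import Data.Integer using (+_)
open import Data.Rational using (ℚ; 0ℚ; 1ℚ; _+_; _*_)
import Data.Rational as ℚ
open import Relation.Binary.PropositionalEquality using (_≡_)
open import Relation.Nullary.Decidable using (does)
open import Data.Bool.Properties using (T?)

record Graph (n : ℕ) : Set where
  field
    adj    : Fin n → Fin n → Bool
    sym    : ∀ i j → adj i j ≡ adj j i
    irrefl : ∀ i → adj i i ≡ false
open Graph public

anyᵇ : {A : Set} → (A → Bool) → List A → Bool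
anyᵇ p = foldr (λ a b → p a ∨ b) false

allᵇ : {A : Set} → (A → Bool) → List A → Bool
allᵇ p = foldr (λ a b → p a ∧ b) true

edges : ∀ {n} → Graph n → ℕ
edges {n} G =
  sum (map (λ i → sum (map (λ j → if (toℕ i <ᵇ toℕ j) ∧ adj G i j then 1 else 0)
                               (allFin n)))
             (allFin n))

_∈ᵇ_ : ∀ {n} → Fin n → Subset n → Bool
v ∈ᵇ S = lookup S v

isDominating : ∀ {n} → Graph n → Subset n → Bool
isDominating {n} G S =
  allᵇ (λ v → (v ∈ᵇ S) ∨ anyᵇ (λ u → (u ∈ᵇ S) ∧ adj G u v) (allFin n)) (allFin n)

allSubsets : (n : ℕ) → List (Subset n)
allSubsets zero = [] ∷ []
allSubsets (suc n) = map (outside ∷_) (allSubsets n) ++ map (inside ∷_) (allSubsets n)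

d : ∀ {n} → Graph n → ℕ → ℕ
d {n} G i = length (filter (λ S → T? (isDominating G S ∧ (∣ S ∣ ≡ᵇ i))) (allSubsets n))

_^_ : ℚ → ℕ → ℚ
x ^ zero = 1ℚ
x ^ suc k = x * (x ^ k)

D : ∀ {n} → Graph n → ℚ → ℚ
D {n} G x = L.foldr _+_ 0ℚ (map (λ i → ((+ d G (suc i)) ℚ./ 1) * (x ^ suc i)) (upTo n))

LeastOptimal : (n m : ℕ) → Graph n → Set
LeastOptimal n m H =
  edges H ≡ m × ((G : Graph n) → edges G ≡ m → (x : ℚ) → 0ℚ ℚ.≤ x → D H x ℚ.≤ D G x)
  where open import Data.Product using (_×_)

-- A graph with n vertices and C(n,2) − k edges is the complement of a graph with k edges. A vertex
-- dominates on its own iff it is isolated in the complement, and if the complement has maximum degree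
-- at most 1, every set of at least two vertices dominates. Let H be least-optimal. If some vertex has
-- degree at least 2 in the complement of H, that complement has more than n − 2k isolated vertices,
-- whereas the complement M of a k-edge matching has exactly n − 2k dominating vertices; so
-- d(M,1) < d(H,1) and D(M,x) < D(H,x) for small x > 0. Otherwise every set of size j ≥ 2 dominates H,
-- while in the complement S of the star K_{1,k} the k leaves do not dominate the centre; so
-- d(S,j) ≤ d(H,j) for j ≥ 2, strictly at j = k, and D(S,x) < D(H,x) for large x. The two comparisons
-- are made at x = 1/B and x = B with B exceeding every coefficient, where they become comparisons of
-- base-B numerals. The hypothesis n ≥ 7 is used only to guarantee k ≤ C(n,2).
module Submission where

open import Algebra.Bundles using (CommutativeRing)
import Algebra.Properties.Semiring.Sum as SemiringSum
open import Data.Bool using (Bool; true; false; T; not; _∧_; _∨_; if_then_else_)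
import Data.Bool.Properties as Bool
open import Data.Bool.Properties using (T?)
open import Data.Empty using (⊥; ⊥-elim)
open import Data.Fin using (Fin; toℕ; fromℕ<) renaming (zero to fzero; suc to fsuc)
import Data.Fin.Properties as Fin
open import Data.Fin.Properties using (any?)
open import Data.Fin.Subset using (Subset; ∣_∣; ⁅_⁆) renaming (⊥ to ∅)
import Data.Fin.Subset.Properties as Subset
import Data.Integer as ℤ
import Data.Integer.Properties as ℤₚ
open import Data.List as List using (List; []; _∷_; allFin; tabulate; map; filter; length; _++_; applyUpTo)
open import Data.List.Membership.Propositional using (_∈_)
open import Data.List.Membership.Propositional.Properties using (∈-map⁺; ∈-++⁺ˡ; ∈-++⁺ʳ)
import Data.List.Properties as Listₚ
open import Data.List.Relation.Unary.Any using (here; there)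
open import Data.Nat as ℕ using (ℕ; zero; suc; _+_; _*_; _∸_; _≤_; _<_; z≤n; s≤s; _≡ᵇ_; _<ᵇ_)
open import Data.Nat.Combinatorics using (_C_; nC1≡n; nCk+nC[k+1]≡[n+1]C[k+1])
open import Data.Nat.Coprimality as Coprimality using (1-coprimeTo)
open import Data.Nat.ListAction using () renaming (sum to listSum)
import Data.Nat.Properties as ℕₚ
open import Algebra.Properties.CommutativeMonoid.Sum ℕₚ.+-0-commutativeMonoid
  using (sum-syntax; sum-cong-≗; sum-replicate-zero; ∑-distrib-+; ∑-comm)
open import Data.Nat.Tactic.RingSolver using (solve-∀)
open import Data.Product using (_×_; _,_; ∃; proj₁; proj₂)
open import Data.Rational as ℚ using (ℚ; mkℚ; 0ℚ; 1ℚ; 1/_)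
  renaming (_+_ to _+ℚ_; _*_ to _*ℚ_; _≤_ to _≤ℚ_; _<_ to _<ℚ_)
import Data.Rational.Properties as ℚₚ
open import Data.Rational.Solver using (module +-*-Solver)
import Data.Rational.Unnormalised as ℚᵘ
import Data.Rational.Unnormalised.Properties as ℚᵘₚ
open import Data.Sum as Sum using (_⊎_; inj₁; inj₂)
import Data.Vec as Vec
open import Data.Vec using ([]; _∷_)
import Data.Vec.Properties as Vecₚ
open import Function using (_∘_; Equivalence)
open import Relation.Binary.Definitions using (tri<; tri≈; tri>)
import Relation.Binary.PropositionalEquality as ≡
open ≡ using (_≡_; refl; cong; cong₂; trans; subst; subst₂; module ≡-Reasoning)
open import Relation.Nullary using (¬_; Dec; yes; no)

open import Defs

open Equivalence using (to; from)

𝟙 : Bool → ℕ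
𝟙 b = if b then 1 else 0

𝟙-mono : ∀ {a b} → (T a → T b) → 𝟙 a ≤ 𝟙 b
𝟙-mono {false}        _   = z≤n
𝟙-mono {true} {true}  _   = ℕₚ.≤-refl
𝟙-mono {true} {false} a⇒b = ⊥-elim (a⇒b _)

T⇒≡true : ∀ {b} → T b → b ≡ true
T⇒≡true = to Bool.T-≡

≡true⇒T : ∀ {b} → b ≡ true → T b
≡true⇒T refl = _

¬T⇒≡false : ∀ {b} → ¬ T b → b ≡ false
¬T⇒≡false {false} _  = refl
¬T⇒≡false {true}  ¬b = ⊥-elim (¬b _)

T-not⇒¬T : ∀ {b} → T (not b) → ¬ T b
T-not⇒¬T {false} _ ()

¬T⇒T-not : ∀ {b} → ¬ T b → T (not b)
¬T⇒T-not {false} _  = _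
¬T⇒T-not {true}  ¬b = ¬b _

T-extensional : ∀ {a b} → (T a → T b) → (T b → T a) → a ≡ b
T-extensional {false} {false} _   _   = refl
T-extensional {false} {true}  _   b⇒a = ⊥-elim (b⇒a _)
T-extensional {true}  {false} a⇒b _   = ⊥-elim (a⇒b _)
T-extensional {true}  {true}  _   _   = refl

-- Finite sums of natural numbers

∑-const : ∀ n c → ∑[ i < n ] c ≡ n * c
∑-const zero    c = refl
∑-const (suc n) c = cong (c +_) (∑-const n c)

∑-1 : ∀ n → ∑[ i < n ] 1 ≡ n
∑-1 zero    = refl
∑-1 (suc n) = cong suc (∑-1 n)

∑-suc : ∀ n (f : Fin n → ℕ) → ∑[ i < n ] suc (f i) ≡ n + ∑[ i < n ] f i
∑-suc n f = trans (∑-distrib-+ {n} (λ _ → 1) f) (cong (_+ ∑[ i < n ] f i) (∑-1 n))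

∑-mono-≤ : ∀ {n} {f g : Fin n → ℕ} → (∀ i → f i ≤ g i) → ∑[ i < n ] f i ≤ ∑[ i < n ] g i
∑-mono-≤ {zero}  f≤g = z≤n
∑-mono-≤ {suc n} f≤g = ℕₚ.+-mono-≤ (f≤g fzero) (∑-mono-≤ (f≤g ∘ fsuc))

∑-mono-< : ∀ {n} {f g : Fin n → ℕ} → (∀ i → f i ≤ g i) → ∀ w → f w < g w →
           ∑[ i < n ] f i < ∑[ i < n ] g i
∑-mono-< f≤g fzero    fw<gw = ℕₚ.+-mono-<-≤ fw<gw (∑-mono-≤ (f≤g ∘ fsuc))
∑-mono-< f≤g (fsuc w) fw<gw = ℕₚ.+-mono-≤-< (f≤g fzero) (∑-mono-< (f≤g ∘ fsuc) w fw<gw)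

f≤∑f : ∀ {n} (f : Fin n → ℕ) i → f i ≤ ∑[ j < n ] f j
f≤∑f f fzero    = ℕₚ.m≤m+n _ _
f≤∑f f (fsuc i) = ℕₚ.≤-trans (f≤∑f (f ∘ fsuc) i) (ℕₚ.m≤n+m _ _)

∑-𝟙-< : ∀ {n c} → c ≤ n → ∑[ i < n ] 𝟙 (toℕ i <ᵇ c) ≡ c
∑-𝟙-< {n}     {zero}  _         = sum-replicate-zero n
∑-𝟙-< {suc n} {suc c} (s≤s c≤n) = cong suc (∑-𝟙-< c≤n)

∑-𝟙-≡ : ∀ {n c} → c < n → ∑[ i < n ] 𝟙 (toℕ i ≡ᵇ c) ≡ 1
∑-𝟙-≡ {suc n} {zero}  _         = cong suc (sum-replicate-zero n)
∑-𝟙-≡ {suc n} {suc c} (s≤s c<n) = ∑-𝟙-≡ c<n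

∑∑-symmetrise : ∀ n (f : Fin n → Fin n → ℕ) →
                ∑[ v < n ] ∑[ u < n ] (f v u + f u v) ≡ 2 * ∑[ v < n ] ∑[ u < n ] f v u
∑∑-symmetrise n f = begin
  ∑[ v < n ] ∑[ u < n ] (f v u + f u v)  ≡⟨ sum-cong-≗ (λ v → ∑-distrib-+ {n} (f v) (λ u → f u v)) ⟩
  ∑[ v < n ] (out v + in′ v)             ≡⟨ ∑-distrib-+ {n} out in′ ⟩
  total + ∑[ v < n ] in′ v               ≡⟨ cong (total +_) (∑-comm (λ v u → f u v)) ⟩
  total + total                          ≡⟨ cong (total +_) (ℕₚ.+-identityʳ total) ⟨
  2 * total                              ∎
  where
  open ≡-Reasoning
  out in′ : Fin n → ℕ
  out v = ∑[ u < n ] f v u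
  in′ v = ∑[ u < n ] f u v
  total : ℕ
  total = ∑[ v < n ] out v

listSum-tabulate : ∀ {n} (f : Fin n → ℕ) → listSum (tabulate f) ≡ ∑[ i < n ] f i
listSum-tabulate {zero}  f = refl
listSum-tabulate {suc n} f = cong (f fzero +_) (listSum-tabulate (f ∘ fsuc))

listSum-allFin : ∀ n (f : Fin n → ℕ) → listSum (map f (allFin n)) ≡ ∑[ i < n ] f i
listSum-allFin n f = trans (cong listSum (Listₚ.map-tabulate {n = n} (λ i → i) f)) (listSum-tabulate f)

zeros : ∀ {n} → (Fin n → ℕ) → ℕ
zeros {n} f = ∑[ i < n ] 𝟙 (f i ≡ᵇ 0)

n<zeros+∑ : ∀ {n} (f : Fin n → ℕ) w → 2 ≤ f w → n < zeros f + ∑[ i < n ] f i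
n<zeros+∑ {n} f w 2≤fw = begin-strict
  n                                ≡⟨ ∑-1 n ⟨
  ∑[ i < n ] 1                     <⟨ ∑-mono-< (positive ∘ f) w (ℕₚ.≤-trans 2≤fw (ℕₚ.m≤n+m _ _)) ⟩
  ∑[ i < n ] (𝟙 (f i ≡ᵇ 0) + f i)  ≡⟨ ∑-distrib-+ {n} (λ i → 𝟙 (f i ≡ᵇ 0)) f ⟩
  zeros f + ∑[ i < n ] f i         ∎
  where
  open ℕₚ.≤-Reasoning
  positive : ∀ m → 1 ≤ 𝟙 (m ≡ᵇ 0) + m
  positive zero    = ℕₚ.≤-refl
  positive (suc m) = s≤s z≤n

zeros+count≤n : ∀ {n} (f : Fin n → ℕ) (p : Fin n → Bool) → (∀ i → T (p i) → 0 < f i) →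
                zeros f + ∑[ i < n ] 𝟙 (p i) ≤ n
zeros+count≤n {n} f p p⇒0<f = begin
  zeros f + ∑[ i < n ] 𝟙 (p i)         ≡⟨ ∑-distrib-+ {n} (λ i → 𝟙 (f i ≡ᵇ 0)) (𝟙 ∘ p) ⟨
  ∑[ i < n ] (𝟙 (f i ≡ᵇ 0) + 𝟙 (p i))  ≤⟨ ∑-mono-≤ disjoint ⟩
  ∑[ i < n ] 1                         ≡⟨ ∑-1 n ⟩
  n                                    ∎
  where
  open ℕₚ.≤-Reasoning
  nonzero : ∀ {m} → 0 < m → (m ≡ᵇ 0) ≡ false
  nonzero (s≤s _) = refl
  𝟙≤1 : ∀ b → 𝟙 b ≤ 1
  𝟙≤1 false = z≤n
  𝟙≤1 true  = ℕₚ.≤-refl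
  disjoint : ∀ i → 𝟙 (f i ≡ᵇ 0) + 𝟙 (p i) ≤ 1
  disjoint i with T? (p i)
  ... | yes pi rewrite T⇒≡true pi | nonzero (p⇒0<f i pi) = ℕₚ.≤-refl
  ... | no ¬pi rewrite ¬T⇒≡false ¬pi | ℕₚ.+-identityʳ (𝟙 (f i ≡ᵇ 0)) = 𝟙≤1 _

-- Complements, degrees and edge counts

≡ᵇ-comm : ∀ m n → (m ≡ᵇ n) ≡ (n ≡ᵇ m)
≡ᵇ-comm zero    zero    = refl
≡ᵇ-comm zero    (suc n) = refl
≡ᵇ-comm (suc m) zero    = refl
≡ᵇ-comm (suc m) (suc n) = ≡ᵇ-comm m n

infix 4 _==_
_==_ : ∀ {n} → Fin n → Fin n → Bool
i == j = toℕ i ≡ᵇ toℕ j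

==⇒≡ : ∀ {n} (i j : Fin n) → T (i == j) → i ≡ j
==⇒≡ i j i==j = Fin.toℕ-injective (ℕₚ.≡ᵇ⇒≡ _ _ i==j)

==-refl : ∀ {n} (i : Fin n) → (i == i) ≡ true
==-refl i = T⇒≡true (ℕₚ.≡⇒≡ᵇ (toℕ i) _ refl)

==-sym : ∀ {n} (i j : Fin n) → (i == j) ≡ (j == i)
==-sym i j = ≡ᵇ-comm (toℕ i) (toℕ j)

==⇒¬adj : ∀ {n} (G : Graph n) i j → T (i == j) → adj G i j ≡ false
==⇒¬adj G i j i==j = subst (λ k → adj G i k ≡ false) (==⇒≡ i j i==j) (irrefl G i)

complement : ∀ {n} → Graph n → Graph n
complement G = record
  { adj    = λ i j → not (i == j) ∧ not (adj G i j)
  ; sym    = λ i j → cong₂ (λ e a → not e ∧ not a) (==-sym i j) (Graph.sym G i j)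
  ; irrefl = λ i → cong (λ e → not e ∧ not (adj G i i)) (==-refl i)
  }

complement-involutive : ∀ {n} (G : Graph n) i j → adj (complement (complement G)) i j ≡ adj G i j
complement-involutive G i j with i == j in i==j
... | true  = ≡.sym (==⇒¬adj G i j (≡true⇒T i==j))
... | false = Bool.not-involutive (adj G i j)

complement⁺ : ∀ {n} (G : Graph n) i j → ¬ T (i == j) → ¬ T (adj G i j) → T (adj (complement G) i j)
complement⁺ G i j i≠j ¬i~j = from Bool.T-∧ (¬T⇒T-not i≠j , ¬T⇒T-not ¬i~j)

complement⁻ : ∀ {n} (G : Graph n) i j → T (adj (complement G) i j) → ¬ T (i == j) × ¬ T (adj G i j)
complement⁻ G i j coadj with to (Bool.T-∧ {not (i == j)} {not (adj G i j)}) coadj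
... | i≠j , ¬i~j = T-not⇒¬T i≠j , T-not⇒¬T ¬i~j

degree : ∀ {n} → Graph n → Fin n → ℕ
degree {n} G v = ∑[ u < n ] 𝟙 (adj G v u)

degree-complement-involutive : ∀ {n} (G : Graph n) v → degree (complement (complement G)) v ≡ degree G v
degree-complement-involutive G v = sum-cong-≗ (cong 𝟙 ∘ complement-involutive G v)

adj⇒0<degree : ∀ {n} (G : Graph n) v u → T (adj G v u) → 0 < degree G v
adj⇒0<degree G v u v~u = ℕₚ.≤-trans (𝟙-mono {true} (λ _ → v~u)) (f≤∑f (λ w → 𝟙 (adj G v w)) u)

suc-degree+degree-complement : ∀ {n} (G : Graph n) v → suc (degree G v + degree (complement G) v) ≡ n
suc-degree+degree-complement {n} G v = begin
  suc (∑[ u < n ] A u + ∑[ u < n ] Aᶜ u)         ≡⟨ cong suc (∑-distrib-+ {n} A Aᶜ) ⟨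
  suc (∑[ u < n ] (A u + Aᶜ u))                  ≡⟨ cong (_+ ∑[ u < n ] (A u + Aᶜ u)) self ⟨
  ∑[ u < n ] I u + ∑[ u < n ] (A u + Aᶜ u)       ≡⟨ ∑-distrib-+ {n} I (λ u → A u + Aᶜ u) ⟨
  ∑[ u < n ] (I u + (A u + Aᶜ u))                ≡⟨ sum-cong-≗ partition ⟩
  ∑[ u < n ] 1                                   ≡⟨ ∑-1 n ⟩
  n                                              ∎
  where
  open ≡-Reasoning
  I A Aᶜ : Fin n → ℕ
  I  u = 𝟙 (v == u)
  A  u = 𝟙 (adj G v u)
  Aᶜ u = 𝟙 (adj (complement G) v u)
  self : ∑[ u < n ] I u ≡ 1
  self = trans (sum-cong-≗ (λ u → cong 𝟙 (==-sym v u))) (∑-𝟙-≡ (Fin.toℕ<n v))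
  partition : ∀ u → I u + (A u + Aᶜ u) ≡ 1
  partition u with v == u in v==u
  ... | true rewrite ==⇒¬adj G v u (≡true⇒T v==u) = refl
  ... | false with adj G v u
  ...   | true  = refl
  ...   | false = refl

handshake : ∀ {n} (G : Graph n) → ∑[ v < n ] degree G v ≡ 2 * edges G
handshake {n} G = begin
  ∑[ v < n ] ∑[ u < n ] 𝟙 (adj G v u)    ≡⟨ sum-cong-≗ (λ v → sum-cong-≗ (orient v)) ⟩
  ∑[ v < n ] ∑[ u < n ] (E v u + E u v)  ≡⟨ ∑∑-symmetrise n E ⟩
  2 * ∑[ v < n ] ∑[ u < n ] E v u        ≡⟨ cong (2 *_) edges-∑ ⟨
  2 * edges G                            ∎
  where
  open ≡-Reasoning
  E : Fin n → Fin n → ℕ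
  E i j = 𝟙 ((toℕ i <ᵇ toℕ j) ∧ adj G i j)
  edges-∑ : edges G ≡ ∑[ i < n ] ∑[ j < n ] E i j
  edges-∑ = trans (listSum-allFin n _) (sum-cong-≗ (λ i → listSum-allFin n (E i)))
  <ᵇ-true : ∀ {a b} → a < b → (a <ᵇ b) ≡ true
  <ᵇ-true = T⇒≡true ∘ ℕₚ.<⇒<ᵇ
  <ᵇ-false : ∀ {a b} → b ≤ a → (a <ᵇ b) ≡ false
  <ᵇ-false b≤a = ¬T⇒≡false (ℕₚ.≤⇒≯ b≤a ∘ ℕₚ.<ᵇ⇒< _ _)
  orient : ∀ v u → 𝟙 (adj G v u) ≡ E v u + E u v
  orient v u with ℕₚ.<-cmp (toℕ v) (toℕ u)
  ... | tri< v<u _ _ rewrite <ᵇ-true v<u | <ᵇ-false (ℕₚ.<⇒≤ v<u) = ≡.sym (ℕₚ.+-identityʳ _)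
  ... | tri≈ _ v≡u _ rewrite Fin.toℕ-injective v≡u | irrefl G u | <ᵇ-false (ℕₚ.≤-refl {toℕ u}) = refl
  ... | tri> _ _ u<v rewrite <ᵇ-true u<v | <ᵇ-false (ℕₚ.<⇒≤ u<v) | Graph.sym G v u = refl

n+2*nC2≡n*n : ∀ n → n + 2 * (n C 2) ≡ n * n
n+2*nC2≡n*n zero    = refl
n+2*nC2≡n*n (suc n) = begin
  suc n + 2 * (suc n C 2)        ≡⟨ cong (λ c → suc n + 2 * c) (nCk+nC[k+1]≡[n+1]C[k+1] n 1) ⟨
  suc n + 2 * (n C 1 + n C 2)    ≡⟨ cong (λ c → suc n + 2 * (c + n C 2)) (nC1≡n n) ⟩
  suc n + 2 * (n + n C 2)        ≡⟨ regroup n (n C 2) ⟩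
  suc n + n + (n + 2 * (n C 2))  ≡⟨ cong (suc n + n +_) (n+2*nC2≡n*n n) ⟩
  suc n + n + n * n              ≡⟨ square n ⟩
  suc n * suc n                  ∎
  where
  open ≡-Reasoning
  regroup : ∀ n c → suc n + 2 * (n + c) ≡ suc n + n + (n + 2 * c)
  regroup = solve-∀
  square : ∀ n → suc n + n + n * n ≡ suc n * suc n
  square = solve-∀

n≤nC2 : ∀ {n} → 3 ≤ n → n ≤ n C 2
n≤nC2 {n} 3≤n = ℕₚ.*-cancelˡ-≤ 2 (ℕₚ.+-cancelˡ-≤ n _ _ (begin
  n + 2 * n        ≤⟨ ℕₚ.*-monoˡ-≤ n 3≤n ⟩
  n * n            ≡⟨ n+2*nC2≡n*n n ⟨
  n + 2 * (n C 2)  ∎))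
  where open ℕₚ.≤-Reasoning

edges+edges-complement : ∀ {n} (G : Graph n) → edges G + edges (complement G) ≡ n C 2
edges+edges-complement {n} G = ℕₚ.*-cancelˡ-≡ _ _ 2 (ℕₚ.+-cancelˡ-≡ n _ _ (begin
  n + 2 * (edges G + edges Gᶜ)                        ≡⟨ cong (n +_) (ℕₚ.*-distribˡ-+ 2 (edges G) _) ⟩
  n + (2 * edges G + 2 * edges Gᶜ)
    ≡⟨ cong₂ (λ a b → n + (a + b)) (handshake G) (handshake Gᶜ) ⟨
  n + (∑[ v < n ] degree G v + ∑[ v < n ] degree Gᶜ v)
    ≡⟨ cong (n +_) (∑-distrib-+ {n} (degree G) (degree Gᶜ)) ⟨
  n + ∑[ v < n ] (degree G v + degree Gᶜ v)           ≡⟨ ∑-suc n (λ v → degree G v + degree Gᶜ v) ⟨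
  ∑[ v < n ] suc (degree G v + degree Gᶜ v)           ≡⟨ sum-cong-≗ (suc-degree+degree-complement G) ⟩
  ∑[ v < n ] n                                        ≡⟨ ∑-const n n ⟩
  n * n                                               ≡⟨ n+2*nC2≡n*n n ⟨
  n + 2 * (n C 2)                                     ∎))
  where
  open ≡-Reasoning
  Gᶜ = complement G

edges-complement : ∀ {n} (G : Graph n) → edges (complement G) ≡ n C 2 ∸ edges G
edges-complement G = trans (≡.sym (ℕₚ.m+n∸m≡n (edges G) _)) (cong (_∸ edges G) (edges+edges-complement G))

-- Domination

Dominated : ∀ {n} → Graph n → Subset n → Fin n → Set
Dominated {n} G S v = T (v ∈ᵇ S) ⊎ ∃ λ u → T (u ∈ᵇ S) × T (adj G u v)

allᵇ-tabulate⁺ : ∀ {A : Set} {n} (p : A → Bool) (f : Fin n → A) →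
                 (∀ i → T (p (f i))) → T (allᵇ p (tabulate f))
allᵇ-tabulate⁺ {n = zero}  p f all = _
allᵇ-tabulate⁺ {n = suc n} p f all = from Bool.T-∧ (all fzero , allᵇ-tabulate⁺ p (f ∘ fsuc) (all ∘ fsuc))

allᵇ-tabulate⁻ : ∀ {A : Set} {n} (p : A → Bool) (f : Fin n → A) →
                 T (allᵇ p (tabulate f)) → ∀ i → T (p (f i))
allᵇ-tabulate⁻ {n = suc n} p f all fzero    = proj₁ (to Bool.T-∧ all)
allᵇ-tabulate⁻ {n = suc n} p f all (fsuc i) = allᵇ-tabulate⁻ p (f ∘ fsuc) (proj₂ (to Bool.T-∧ all)) i

anyᵇ-tabulate⁺ : ∀ {A : Set} {n} (p : A → Bool) (f : Fin n → A) i →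
                 T (p (f i)) → T (anyᵇ p (tabulate f))
anyᵇ-tabulate⁺ p f fzero    pfi = from Bool.T-∨ (inj₁ pfi)
anyᵇ-tabulate⁺ p f (fsuc i) pfi = from Bool.T-∨ (inj₂ (anyᵇ-tabulate⁺ p (f ∘ fsuc) i pfi))

anyᵇ-tabulate⁻ : ∀ {A : Set} {n} (p : A → Bool) (f : Fin n → A) →
                 T (anyᵇ p (tabulate f)) → ∃ λ i → T (p (f i))
anyᵇ-tabulate⁻ {n = suc n} p f any with to Bool.T-∨ any
... | inj₁ pf0  = fzero , pf0
... | inj₂ any′ with anyᵇ-tabulate⁻ p (f ∘ fsuc) any′
...   | i , pfi = fsuc i , pfi

isDominating⁺ : ∀ {n} (G : Graph n) S → (∀ v → Dominated G S v) → T (isDominating G S)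
isDominating⁺ {n} G S dom = allᵇ-tabulate⁺ _ (λ v → v) (λ v → from Bool.T-∨ (Sum.map₂ witness (dom v)))
  where
  witness : ∀ {v} → (∃ λ u → T (u ∈ᵇ S) × T (adj G u v)) →
            T (anyᵇ (λ u → (u ∈ᵇ S) ∧ adj G u v) (allFin n))
  witness (u , u∈S , u~v) = anyᵇ-tabulate⁺ _ (λ u → u) u (from Bool.T-∧ (u∈S , u~v))

isDominating⁻ : ∀ {n} (G : Graph n) S → T (isDominating G S) → ∀ v → Dominated G S v
isDominating⁻ {n} G S dom v = Sum.map₂ witness (to Bool.T-∨ (allᵇ-tabulate⁻ _ (λ v → v) dom v))
  where
  witness : T (anyᵇ (λ u → (u ∈ᵇ S) ∧ adj G u v) (allFin n)) → ∃ λ u → T (u ∈ᵇ S) × T (adj G u v)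
  witness any with anyᵇ-tabulate⁻ _ (λ u → u) any
  ... | u , u∈S∧u~v = u , to Bool.T-∧ u∈S∧u~v

∈ᵇ⁅⁆⇒≡ : ∀ {n} {u v : Fin n} → T (u ∈ᵇ ⁅ v ⁆) → u ≡ v
∈ᵇ⁅⁆⇒≡ {u = u} {v} = Subset.x∈⁅y⁆⇒x≡y v ∘ Vecₚ.lookup⇒[]= u ⁅ v ⁆ ∘ T⇒≡true

v∈ᵇ⁅v⁆ : ∀ {n} (v : Fin n) → T (v ∈ᵇ ⁅ v ⁆)
v∈ᵇ⁅v⁆ v = ≡true⇒T (Vecₚ.[]=⇒lookup (Subset.x∈⁅x⁆ v))

isDominating-⁅⁆⁺ : ∀ {n} (G : Graph n) v → degree (complement G) v ≡ 0 → T (isDominating G ⁅ v ⁆)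
isDominating-⁅⁆⁺ G v codeg≡0 = isDominating⁺ G ⁅ v ⁆ dominated
  where
  dominated : ∀ u → Dominated G ⁅ v ⁆ u
  dominated u with T? (v == u) | T? (adj G v u)
  ... | yes v==u | _       = inj₁ (subst (λ w → T (w ∈ᵇ ⁅ v ⁆)) (==⇒≡ v u v==u) (v∈ᵇ⁅v⁆ v))
  ... | no _     | yes v~u = inj₂ (v , v∈ᵇ⁅v⁆ v , v~u)
  ... | no v≠u   | no ¬v~u =
    ⊥-elim (ℕₚ.<⇒≢ (adj⇒0<degree (complement G) v u (complement⁺ G v u v≠u ¬v~u)) (≡.sym codeg≡0))

isDominating-⁅⁆⁻ : ∀ {n} (G : Graph n) v → T (isDominating G ⁅ v ⁆) → degree (complement G) v ≡ 0
isDominating-⁅⁆⁻ {n} G v dom =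
  trans (sum-cong-≗ (cong 𝟙 ∘ ¬T⇒≡false ∘ ¬coadj)) (sum-replicate-zero n)
  where
  ¬coadj : ∀ u → ¬ T (adj (complement G) v u)
  ¬coadj u coadj with complement⁻ G v u coadj | isDominating⁻ G ⁅ v ⁆ dom u
  ... | v≠u , _  | inj₁ u∈⁅v⁆ =
    v≠u (subst (λ w → T (v == w)) (≡.sym (∈ᵇ⁅⁆⇒≡ u∈⁅v⁆)) (≡true⇒T (==-refl v)))
  ... | _ , ¬v~u | inj₂ (w , w∈⁅v⁆ , w~u) =
    ¬v~u (subst (λ w → T (adj G w u)) (∈ᵇ⁅⁆⇒≡ w∈⁅v⁆) w~u)

isDominating-⁅⁆ : ∀ {n} (G : Graph n) v → isDominating G ⁅ v ⁆ ≡ (degree (complement G) v ≡ᵇ 0)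
isDominating-⁅⁆ G v =
  T-extensional (ℕₚ.≡⇒≡ᵇ _ 0 ∘ isDominating-⁅⁆⁻ G v)
                (isDominating-⁅⁆⁺ G v ∘ ℕₚ.≡ᵇ⇒≡ _ 0)

∣S∣≡∑ : ∀ {n} (S : Subset n) → ∣ S ∣ ≡ ∑[ u < n ] 𝟙 (u ∈ᵇ S)
∣S∣≡∑ []          = refl
∣S∣≡∑ (true ∷ S)  = cong suc (∣S∣≡∑ S)
∣S∣≡∑ (false ∷ S) = ∣S∣≡∑ S

isDominating-sparse-complement : ∀ {n} (G : Graph n) → (∀ v → degree (complement G) v ≤ 1) →
                                 ∀ S → 2 ≤ ∣ S ∣ → T (isDominating G S)
isDominating-sparse-complement {n} G sparse S 2≤∣S∣ = isDominating⁺ G S dominated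
  where
  dominated : ∀ v → Dominated G S v
  dominated v with T? (v ∈ᵇ S) | any? (λ u → T? ((u ∈ᵇ S) ∧ adj G u v))
  ... | yes v∈S | _                 = inj₁ v∈S
  ... | no _    | yes (u , u∈S∧u~v) = inj₂ (u , to Bool.T-∧ u∈S∧u~v)
  ... | no v∉S  | no ¬dominated     = ⊥-elim (ℕₚ.<⇒≱ 2≤∣S∣ (begin
    ∣ S ∣                     ≡⟨ ∣S∣≡∑ S ⟩
    ∑[ u < n ] 𝟙 (u ∈ᵇ S)     ≤⟨ ∑-mono-≤ (λ u → 𝟙-mono (S⊆coneighbours u)) ⟩
    degree (complement G) v   ≤⟨ sparse v ⟩
    1                         ∎))
    where
    open ℕₚ.≤-Reasoning
    S⊆coneighbours : ∀ u → T (u ∈ᵇ S) → T (adj (complement G) v u)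
    S⊆coneighbours u u∈S = complement⁺ G v u v≠u ¬v~u
      where
      v≠u : ¬ T (v == u)
      v≠u v==u = v∉S (subst (λ w → T (w ∈ᵇ S)) (≡.sym (==⇒≡ v u v==u)) u∈S)
      ¬v~u : ¬ T (adj G v u)
      ¬v~u v~u = ¬dominated (u , from Bool.T-∧ (u∈S , subst T (Graph.sym G v u) v~u))

-- Counting dominating sets

count : ∀ {A : Set} → (A → Bool) → List A → ℕ
count p xs = length (filter (T? ∘ p) xs)

count-∷ : ∀ {A : Set} (p : A → Bool) x xs → count p (x ∷ xs) ≡ 𝟙 (p x) + count p xs
count-∷ p x xs with p x
... | true  = refl
... | false = refl

count-++ : ∀ {A : Set} (p : A → Bool) xs ys → count p (xs ++ ys) ≡ count p xs + count p ys
count-++ p xs ys = trans (cong length (Listₚ.filter-++ (T? ∘ p) xs ys)) (Listₚ.length-++ (filter (T? ∘ p) xs))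

count-map : ∀ {A B : Set} (p : B → Bool) (f : A → B) xs → count p (map f xs) ≡ count (p ∘ f) xs
count-map p f []       = refl
count-map p f (x ∷ xs) rewrite count-∷ p (f x) (map f xs) | count-∷ (p ∘ f) x xs =
  cong (𝟙 (p (f x)) +_) (count-map p f xs)

count-none : ∀ {A : Set} (p : A → Bool) → (∀ x → ¬ T (p x)) → ∀ xs → count p xs ≡ 0
count-none p none []       = refl
count-none p none (x ∷ xs) rewrite ¬T⇒≡false (none x) = count-none p none xs

count-mono : ∀ {A : Set} {p q : A → Bool} → (∀ x → T (p x) → T (q x)) →
             ∀ xs → count p xs ≤ count q xs
count-mono p⇒q []       = z≤n
count-mono {p = p} {q} p⇒q (x ∷ xs) rewrite count-∷ p x xs | count-∷ q x xs =
  ℕₚ.+-mono-≤ (𝟙-mono (p⇒q x)) (count-mono p⇒q xs)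

count-mono-< : ∀ {A : Set} {p q : A → Bool} → (∀ x → T (p x) → T (q x)) →
               ∀ {y} xs → y ∈ xs → ¬ T (p y) → T (q y) → count p xs < count q xs
count-mono-< {p = p} {q} p⇒q (x ∷ xs) (here refl) ¬py qy
  rewrite count-∷ p x xs | count-∷ q x xs | ¬T⇒≡false ¬py | T⇒≡true qy = s≤s (count-mono p⇒q xs)
count-mono-< {p = p} {q} p⇒q (x ∷ xs) (there y∈xs) ¬py qy
  rewrite count-∷ p x xs | count-∷ q x xs =
  ℕₚ.+-mono-≤-< (𝟙-mono (p⇒q x)) (count-mono-< p⇒q xs y∈xs ¬py qy)

∈-allSubsets : ∀ {n} (S : Subset n) → S ∈ allSubsets n
∈-allSubsets []          = here refl
∈-allSubsets (false ∷ S) = ∈-++⁺ˡ (∈-map⁺ (false ∷_) (∈-allSubsets S))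
∈-allSubsets (true ∷ S)  = ∈-++⁺ʳ (map (false ∷_) (allSubsets _)) (∈-map⁺ (true ∷_) (∈-allSubsets S))

count-allSubsets : ∀ {n} (p : Subset (suc n) → Bool) → count p (allSubsets (suc n)) ≡
                   count (p ∘ (false ∷_)) (allSubsets n) + count (p ∘ (true ∷_)) (allSubsets n)
count-allSubsets {n} p =
  trans (count-++ p (map (false ∷_) (allSubsets n)) _)
        (cong₂ _+_ (count-map p (false ∷_) (allSubsets n)) (count-map p (true ∷_) (allSubsets n)))

count-size₀ : ∀ n (P : Subset n → Bool) →
              count (λ S → P S ∧ (∣ S ∣ ≡ᵇ 0)) (allSubsets n) ≡ 𝟙 (P ∅)
count-size₀ zero    P with P []
... | true  = refl
... | false = refl
count-size₀ (suc n) P = begin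
  count (λ S → P S ∧ (∣ S ∣ ≡ᵇ 0)) (allSubsets (suc n))
    ≡⟨ count-allSubsets (λ S → P S ∧ (∣ S ∣ ≡ᵇ 0)) ⟩
  count (λ S → P (false ∷ S) ∧ (∣ S ∣ ≡ᵇ 0)) (allSubsets n)
    + count (λ S → P (true ∷ S) ∧ false) (allSubsets n)
    ≡⟨ cong₂ _+_ (count-size₀ n (P ∘ (false ∷_)))
                 (count-none _ (λ S → proj₂ ∘ to Bool.T-∧) (allSubsets n)) ⟩
  𝟙 (P ∅) + 0
    ≡⟨ ℕₚ.+-identityʳ _ ⟩
  𝟙 (P ∅) ∎
  where open ≡-Reasoning

count-size₁ : ∀ n (P : Subset n → Bool) →
              count (λ S → P S ∧ (∣ S ∣ ≡ᵇ 1)) (allSubsets n) ≡ ∑[ v < n ] 𝟙 (P ⁅ v ⁆)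
count-size₁ zero    P with P []
... | true  = refl
... | false = refl
count-size₁ (suc n) P = begin
  count (λ S → P S ∧ (∣ S ∣ ≡ᵇ 1)) (allSubsets (suc n))
    ≡⟨ count-allSubsets (λ S → P S ∧ (∣ S ∣ ≡ᵇ 1)) ⟩
  count (λ S → P (false ∷ S) ∧ (∣ S ∣ ≡ᵇ 1)) (allSubsets n)
    + count (λ S → P (true ∷ S) ∧ (∣ S ∣ ≡ᵇ 0)) (allSubsets n)
    ≡⟨ cong₂ _+_ (count-size₁ n (P ∘ (false ∷_))) (count-size₀ n (P ∘ (true ∷_))) ⟩
  ∑[ v < n ] 𝟙 (P (false ∷ ⁅ v ⁆)) + 𝟙 (P (true ∷ ∅))
    ≡⟨ ℕₚ.+-comm _ (𝟙 (P (true ∷ ∅))) ⟩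
  ∑[ v < suc n ] 𝟙 (P ⁅ v ⁆) ∎
  where open ≡-Reasoning

d-1≡zeros : ∀ {n} (G : Graph n) → d G 1 ≡ zeros (degree (complement G))
d-1≡zeros {n} G = trans (count-size₁ n (isDominating G)) (sum-cong-≗ (cong 𝟙 ∘ isDominating-⁅⁆ G))

d≤#subsets : ∀ {n} (G : Graph n) j → d G j ≤ length (allSubsets n)
d≤#subsets {n} G j = Listₚ.length-filter _ (allSubsets n)

module _ {n} (G H : Graph n) (j : ℕ)
         (G⇒H : ∀ S → ∣ S ∣ ≡ j → T (isDominating G S) → T (isDominating H S)) where

  private
    sized : ∀ S → T (isDominating G S ∧ (∣ S ∣ ≡ᵇ j)) → T (isDominating H S ∧ (∣ S ∣ ≡ᵇ j))
    sized S domG∧sized with to Bool.T-∧ domG∧sized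
    ... | domG , ∣S∣≡j = from Bool.T-∧ (G⇒H S (ℕₚ.≡ᵇ⇒≡ _ _ ∣S∣≡j) domG , ∣S∣≡j)

  d-mono : d G j ≤ d H j
  d-mono = count-mono sized (allSubsets n)

  d-mono-< : ∀ S → ∣ S ∣ ≡ j → ¬ T (isDominating G S) → T (isDominating H S) → d G j < d H j
  d-mono-< S ∣S∣≡j ¬domG domH = count-mono-< sized (allSubsets n) (∈-allSubsets S)
    (¬domG ∘ proj₁ ∘ to Bool.T-∧) (from Bool.T-∧ (domH , ℕₚ.≡⇒≡ᵇ _ _ ∣S∣≡j))

-- Evaluating domination polynomials

ι : ℕ → ℚ
ι a = ℤ.+ a ℚ./ 1

-- The normal form of ι a, which unlike ι a computes: normalisation goes through gcd.
ι′ : ℕ → ℚ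
ι′ a = mkℚ (ℤ.+ a) 0 (Coprimality.sym (1-coprimeTo a))

ι≡ι′ : ∀ a → ι a ≡ ι′ a
ι≡ι′ a = ℚₚ.normalize-coprime (Coprimality.sym (1-coprimeTo a))

ι-+ : ∀ a b → ι (a + b) ≡ ι a +ℚ ι b
ι-+ a b rewrite ι≡ι′ a | ι≡ι′ b | ι≡ι′ (a + b) = ℚₚ.toℚᵘ-injective (ℚᵘₚ.≃-sym
  (ℚᵘₚ.≃-trans (ℚₚ.toℚᵘ-homo-+ (ι′ a) (ι′ b))
    (ℚᵘ.*≡* (cong (ℤ._* ℤ.+ 1)
      (cong₂ ℤ._+_ (ℤₚ.*-identityʳ (ℤ.+ a)) (ℤₚ.*-identityʳ (ℤ.+ b)))))))

ι-* : ∀ a b → ι (a * b) ≡ ι a *ℚ ι b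
ι-* a b rewrite ι≡ι′ a | ι≡ι′ b | ι≡ι′ (a * b) = ℚₚ.toℚᵘ-injective (ℚᵘₚ.≃-sym
  (ℚᵘₚ.≃-trans (ℚₚ.toℚᵘ-homo-* (ι′ a) (ι′ b))
    (ℚᵘ.*≡* (cong (ℤ._* ℤ.+ 1) (≡.sym (ℤₚ.pos-* a b))))))

ι-mono-< : ∀ {a b} → a < b → ι a <ℚ ι b
ι-mono-< {a} {b} a<b rewrite ι≡ι′ a | ι≡ι′ b =
  ℚ.*<* (subst₂ ℤ._<_ (≡.sym (ℤₚ.*-identityʳ (ℤ.+ a))) (≡.sym (ℤₚ.*-identityʳ (ℤ.+ b)))
                      (ℤ.+<+ a<b))

0≤ι : ∀ a → 0ℚ ≤ℚ ι a
0≤ι a rewrite ι≡ι′ a = ℚₚ.nonNegative⁻¹ (ι′ a)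

*-cancelˡ-<-ι : ∀ a {p q} → ι a *ℚ p <ℚ ι a *ℚ q → p <ℚ q
*-cancelˡ-<-ι a rewrite ι≡ι′ a = ℚₚ.*-cancelˡ-<-nonNeg (ι′ a)

module ℚΣ = SemiringSum (CommutativeRing.semiring ℚₚ.+-*-commutativeRing)

poly : ℕ → (ℕ → ℕ) → ℚ → ℚ
poly n a x = ℚΣ.sum {n} (λ i → ι (a (toℕ i)) *ℚ x ^ suc (toℕ i))

foldr-map-applyUpTo : ∀ n (f : ℕ → ℚ) (g : ℕ → ℕ) →
                      List.foldr _+ℚ_ 0ℚ (map f (applyUpTo g n)) ≡ ℚΣ.sum {n} (λ i → f (g (toℕ i)))
foldr-map-applyUpTo zero    f g = refl
foldr-map-applyUpTo (suc n) f g = cong (f (g 0) +ℚ_) (foldr-map-applyUpTo n f (g ∘ suc))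

D≡poly : ∀ {n} (G : Graph n) x → D G x ≡ poly n (λ i → d G (suc i)) x
D≡poly {n} G x = foldr-map-applyUpTo n _ (λ i → i)

poly-suc : ∀ n a x → poly (suc n) a x ≡ x *ℚ (ι (a 0) +ℚ poly n (a ∘ suc) x)
poly-suc n a x = begin
  ι (a 0) *ℚ (x *ℚ 1ℚ) +ℚ ℚΣ.sum {n} (λ i → ι (a (suc (toℕ i))) *ℚ (x *ℚ x ^ suc (toℕ i)))
    ≡⟨ cong₂ _+ℚ_ (trans (cong (ι (a 0) *ℚ_) (ℚₚ.*-identityʳ x)) (ℚₚ.*-comm (ι (a 0)) x))
                  (ℚΣ.sum-cong-≗ {n} (λ i → swap (ι (a (suc (toℕ i)))) x (x ^ suc (toℕ i)))) ⟩
  x *ℚ ι (a 0) +ℚ ℚΣ.sum {n} (λ i → x *ℚ term i)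
    ≡⟨ cong (x *ℚ ι (a 0) +ℚ_) (ℚΣ.*-distribˡ-sum {n} x term) ⟨
  x *ℚ ι (a 0) +ℚ x *ℚ poly n (a ∘ suc) x
    ≡⟨ ℚₚ.*-distribˡ-+ x (ι (a 0)) _ ⟨
  x *ℚ (ι (a 0) +ℚ poly n (a ∘ suc) x) ∎
  where
  open ≡-Reasoning
  term : Fin n → ℚ
  term i = ι (a (suc (toℕ i))) *ℚ x ^ suc (toℕ i)
  open +-*-Solver using (solve; _:*_; _:=_)
  swap : ∀ c x y → c *ℚ (x *ℚ y) ≡ x *ℚ (c *ℚ y)
  swap = solve 3 (λ c x y → c :* (x :* y) := x :* (c :* y)) refl

module _ (m : ℕ) where

  private
    B : ℕ
    B = suc m

  -- Base B numerals with digits a 0, …, a (n - 1), least resp. most significant digit first.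
  horner : ℕ → (ℕ → ℕ) → ℕ
  horner zero    a = 0
  horner (suc n) a = a 0 + B * horner n (a ∘ suc)

  hornerᵣ : ℕ → (ℕ → ℕ) → ℕ
  hornerᵣ zero    a = 0
  hornerᵣ (suc n) a = a 0 * B ℕ.^ n + hornerᵣ n (a ∘ suc)

  1/B : ℚ
  1/B = 1/ ι′ B

  0≤1/B : 0ℚ ≤ℚ 1/B
  0≤1/B = ℚₚ.nonNegative⁻¹ 1/B

  poly-ι : ∀ n a → poly n a (ι B) ≡ ι (B * horner n a)
  poly-ι zero    a = cong ι (≡.sym (ℕₚ.*-zeroʳ B))
  poly-ι (suc n) a = begin
    poly (suc n) a (ι B)
      ≡⟨ poly-suc n a (ι B) ⟩
    ι B *ℚ (ι (a 0) +ℚ poly n (a ∘ suc) (ι B))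
      ≡⟨ cong (λ p → ι B *ℚ (ι (a 0) +ℚ p)) (poly-ι n (a ∘ suc)) ⟩
    ι B *ℚ (ι (a 0) +ℚ ι (B * horner n (a ∘ suc)))
      ≡⟨ cong (ι B *ℚ_) (ι-+ (a 0) (B * horner n (a ∘ suc))) ⟨
    ι B *ℚ ι (horner (suc n) a)
      ≡⟨ ι-* B (horner (suc n) a) ⟨
    ι (B * horner (suc n) a) ∎
    where open ≡-Reasoning

  poly-1/B : ∀ n a → ι (B ℕ.^ n) *ℚ poly n a 1/B ≡ ι (hornerᵣ n a)
  poly-1/B zero    a = ℚₚ.*-zeroʳ (ι 1)
  poly-1/B (suc n) a = begin
    ι (B * Bⁿ) *ℚ poly (suc n) a 1/B
      ≡⟨ cong₂ _*ℚ_ (ι-* B Bⁿ) (poly-suc n a 1/B) ⟩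
    (ι B *ℚ ι Bⁿ) *ℚ (1/B *ℚ (ι (a 0) +ℚ poly n (a ∘ suc) 1/B))
      ≡⟨ regroup (ι B) (ι Bⁿ) 1/B (ι (a 0)) (poly n (a ∘ suc) 1/B) ⟩
    (ι B *ℚ 1/B) *ℚ (ι (a 0) *ℚ ι Bⁿ +ℚ ι Bⁿ *ℚ poly n (a ∘ suc) 1/B)
      ≡⟨ cong₂ (λ u v → u *ℚ (ι (a 0) *ℚ ι Bⁿ +ℚ v)) B*1/B (poly-1/B n (a ∘ suc)) ⟩
    1ℚ *ℚ (ι (a 0) *ℚ ι Bⁿ +ℚ ι (hornerᵣ n (a ∘ suc)))
      ≡⟨ ℚₚ.*-identityˡ (ι (a 0) *ℚ ι Bⁿ +ℚ ι (hornerᵣ n (a ∘ suc))) ⟩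
    ι (a 0) *ℚ ι Bⁿ +ℚ ι (hornerᵣ n (a ∘ suc))
      ≡⟨ cong (_+ℚ ι (hornerᵣ n (a ∘ suc))) (ι-* (a 0) Bⁿ) ⟨
    ι (a 0 * Bⁿ) +ℚ ι (hornerᵣ n (a ∘ suc))
      ≡⟨ ι-+ (a 0 * Bⁿ) (hornerᵣ n (a ∘ suc)) ⟨
    ι (hornerᵣ (suc n) a) ∎
    where
    open ≡-Reasoning
    open +-*-Solver using (solve; _:*_; _:+_; _:=_)
    Bⁿ : ℕ
    Bⁿ = B ℕ.^ n
    B*1/B : ι B *ℚ 1/B ≡ 1ℚ
    B*1/B = trans (cong (_*ℚ 1/B) (ι≡ι′ B)) (ℚₚ.*-inverseʳ (ι′ B))
    regroup : ∀ b c x a p → (b *ℚ c) *ℚ (x *ℚ (a +ℚ p)) ≡ (b *ℚ x) *ℚ (a *ℚ c +ℚ c *ℚ p)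
    regroup = solve 5 (λ b c x a p → (b :* c) :* (x :* (a :+ p)) := (b :* x) :* (a :* c :+ c :* p)) refl

  horner-mono-≤ : ∀ n {a c} → (∀ i → a i ≤ c i) → horner n a ≤ horner n c
  horner-mono-≤ zero    a≤c = z≤n
  horner-mono-≤ (suc n) a≤c = ℕₚ.+-mono-≤ (a≤c 0) (ℕₚ.*-monoʳ-≤ B (horner-mono-≤ n (a≤c ∘ suc)))

  horner-mono-< : ∀ n p {a c} → p < n → (∀ i → a i ≤ m) →
                  a p < c p → (∀ i → p < i → a i ≤ c i) →
                  horner n a < horner n c
  horner-mono-< (suc n) zero    _         a≤m a0<c0 a≤c =
    ℕₚ.+-mono-<-≤ a0<c0 (ℕₚ.*-monoʳ-≤ B (horner-mono-≤ n (λ i → a≤c (suc i) (s≤s z≤n))))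
  horner-mono-< (suc n) (suc p) {a} {c} (s≤s p<n) a≤m ap<cp a≤c = begin-strict
    a 0 + B * horner n (a ∘ suc)  <⟨ ℕₚ.+-monoˡ-< (B * horner n (a ∘ suc)) (s≤s (a≤m 0)) ⟩
    B + B * horner n (a ∘ suc)    ≡⟨ ℕₚ.*-suc B (horner n (a ∘ suc)) ⟨
    B * suc (horner n (a ∘ suc))  ≤⟨ ℕₚ.*-monoʳ-≤ B tail< ⟩
    B * horner n (c ∘ suc)        ≤⟨ ℕₚ.m≤n+m _ (c 0) ⟩
    c 0 + B * horner n (c ∘ suc)  ∎
    where
    open ℕₚ.≤-Reasoning
    tail< : horner n (a ∘ suc) < horner n (c ∘ suc)
    tail< = horner-mono-< n p p<n (a≤m ∘ suc) ap<cp (λ i → a≤c (suc i) ∘ s≤s)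

  hornerᵣ<B^n : ∀ n {a} → (∀ i → a i ≤ m) → hornerᵣ n a < B ℕ.^ n

  hornerᵣ-suc< : ∀ n {a} → (∀ i → a i ≤ m) → hornerᵣ (suc n) a < suc (a 0) * B ℕ.^ n
  hornerᵣ-suc< n {a} a≤m = begin-strict
    a 0 * B ℕ.^ n + hornerᵣ n (a ∘ suc)  <⟨ ℕₚ.+-monoʳ-< _ (hornerᵣ<B^n n (a≤m ∘ suc)) ⟩
    a 0 * B ℕ.^ n + B ℕ.^ n              ≡⟨ ℕₚ.+-comm (a 0 * B ℕ.^ n) _ ⟩
    suc (a 0) * B ℕ.^ n                  ∎
    where open ℕₚ.≤-Reasoning

  hornerᵣ<B^n zero    a≤m = s≤s z≤n
  hornerᵣ<B^n (suc n) a≤m =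
    ℕₚ.<-≤-trans (hornerᵣ-suc< n a≤m) (ℕₚ.*-monoˡ-≤ (B ℕ.^ n) (s≤s (a≤m 0)))

  hornerᵣ-mono-< : ∀ n {a c} → (∀ i → a i ≤ m) → a 0 < c 0 → hornerᵣ (suc n) a < hornerᵣ (suc n) c
  hornerᵣ-mono-< n {a} {c} a≤m a0<c0 = begin-strict
    hornerᵣ (suc n) a      <⟨ hornerᵣ-suc< n a≤m ⟩
    suc (a 0) * B ℕ.^ n    ≤⟨ ℕₚ.*-monoˡ-≤ (B ℕ.^ n) a0<c0 ⟩
    c 0 * B ℕ.^ n          ≤⟨ ℕₚ.m≤m+n _ _ ⟩
    hornerᵣ (suc n) c      ∎
    where open ℕₚ.≤-Reasoning

  poly-mono-<-at-B : ∀ n p {a c} → p < n → (∀ i → a i ≤ m) →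
                     a p < c p → (∀ i → p < i → a i ≤ c i) →
                     poly n a (ι B) <ℚ poly n c (ι B)
  poly-mono-<-at-B n p {a} {c} p<n a≤m ap<cp a≤c rewrite poly-ι n a | poly-ι n c =
    ι-mono-< (ℕₚ.*-monoʳ-< B (horner-mono-< n p p<n a≤m ap<cp a≤c))

  poly-mono-<-at-1/B : ∀ n {a c} → (∀ i → a i ≤ m) → a 0 < c 0 →
                       poly (suc n) a 1/B <ℚ poly (suc n) c 1/B
  poly-mono-<-at-1/B n {a} {c} a≤m a0<c0 = *-cancelˡ-<-ι (B ℕ.^ suc n)
    (subst₂ _<ℚ_ (≡.sym (poly-1/B (suc n) a)) (≡.sym (poly-1/B (suc n) c))
                 (ι-mono-< (hornerᵣ-mono-< n {a} {c} a≤m a0<c0)))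

D<D-for-small-x : ∀ {n} (G H : Graph (suc n)) → d G 1 < d H 1 → ∃ λ x → 0ℚ ≤ℚ x × D G x <ℚ D H x
D<D-for-small-x {n} G H dG1<dH1 = 1/B M , 0≤1/B M ,
  subst₂ _<ℚ_ (≡.sym (D≡poly G (1/B M))) (≡.sym (D≡poly H (1/B M)))
    (poly-mono-<-at-1/B M n {λ i → d G (suc i)} {λ i → d H (suc i)}
      (λ i → d≤#subsets G (suc i)) dG1<dH1)
  where M = length (allSubsets (suc n))

D<D-for-large-x : ∀ {n} (G H : Graph n) p → p < n → d G (suc p) < d H (suc p) →
                  (∀ j → suc p < j → d G j ≤ d H j) → ∃ λ x → 0ℚ ≤ℚ x × D G x <ℚ D H x
D<D-for-large-x {n} G H p p<n dGp<dHp dG≤dH = ι (suc M) , 0≤ι (suc M) ,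
  subst₂ _<ℚ_ (≡.sym (D≡poly G (ι (suc M)))) (≡.sym (D≡poly H (ι (suc M))))
    (poly-mono-<-at-B M n p {λ i → d G (suc i)} {λ i → d H (suc i)} p<n
      (λ i → d≤#subsets G (suc i)) dGp<dHp (λ i p<i → dG≤dH (suc i) (s≤s p<i)))
  where M = length (allSubsets n)

-- The two competing graphs

module _ (n : ℕ) (R : ℕ → ℕ → Bool) (R-asym : ∀ a b → T (R a b) → ¬ T (R b a)) where

  underlyingGraph : Graph n
  underlyingGraph = record
    { adj    = λ i j → R (toℕ i) (toℕ j) ∨ R (toℕ j) (toℕ i)
    ; sym    = λ i j → Bool.∨-comm (R (toℕ i) (toℕ j)) _
    ; irrefl = λ i → ¬T⇒≡false (Sum.[ irreflexive , irreflexive ] ∘ to Bool.T-∨)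
    }
    where
    irreflexive : ∀ {a} → ¬ T (R a a)
    irreflexive {a} r = R-asym a a r r

  arc⇒adj : ∀ v u → T (R (toℕ v) (toℕ u)) ⊎ T (R (toℕ u) (toℕ v)) → T (adj underlyingGraph v u)
  arc⇒adj v u = from (Bool.T-∨ {R (toℕ v) (toℕ u)} {R (toℕ u) (toℕ v)})

  edges-underlyingGraph : edges underlyingGraph ≡ ∑[ v < n ] ∑[ u < n ] 𝟙 (R (toℕ v) (toℕ u))
  edges-underlyingGraph = ℕₚ.*-cancelˡ-≡ _ _ 2 (begin
    2 * edges underlyingGraph                ≡⟨ handshake underlyingGraph ⟨
    ∑[ v < n ] degree underlyingGraph v      ≡⟨ sum-cong-≗ (λ v → sum-cong-≗ (split v)) ⟩
    ∑[ v < n ] ∑[ u < n ] (A v u + A u v)    ≡⟨ ∑∑-symmetrise n A ⟩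
    2 * ∑[ v < n ] ∑[ u < n ] A v u          ∎)
    where
    open ≡-Reasoning
    A : Fin n → Fin n → ℕ
    A v u = 𝟙 (R (toℕ v) (toℕ u))
    split : ∀ v u → 𝟙 (adj underlyingGraph v u) ≡ A v u + A u v
    split v u with R (toℕ v) (toℕ u) in r | R (toℕ u) (toℕ v) in r′
    ... | true  | true  = ⊥-elim (R-asym _ _ (≡true⇒T r) (≡true⇒T r′))
    ... | true  | false = refl
    ... | false | true  = refl
    ... | false | false = refl

matchingArc : ℕ → ℕ → ℕ → Bool
matchingArc k a b = (a <ᵇ k) ∧ (b ≡ᵇ a + k)

matchingArc⁺ : ∀ {k a b} → a < k → b ≡ a + k → T (matchingArc k a b)
matchingArc⁺ a<k b≡a+k = from Bool.T-∧ (ℕₚ.<⇒<ᵇ a<k , ℕₚ.≡⇒≡ᵇ _ _ b≡a+k)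

matchingArc-asym : ∀ k a b → T (matchingArc k a b) → ¬ T (matchingArc k b a)
matchingArc-asym k a b ab ba = ℕₚ.<⇒≱ b<k (subst (k ≤_) (≡.sym b≡a+k) (ℕₚ.m≤n+m k a))
  where
  b≡a+k : b ≡ a + k
  b≡a+k = ℕₚ.≡ᵇ⇒≡ b (a + k) (proj₂ (to Bool.T-∧ ab))
  b<k : b < k
  b<k = ℕₚ.<ᵇ⇒< b k (proj₁ (to Bool.T-∧ ba))

matching : ∀ n k → Graph n
matching n k = underlyingGraph n (matchingArc k) (matchingArc-asym k)

module _ {n k : ℕ} (2k≤n : 2 * k ≤ n) where

  private
    k+k≤n : k + k ≤ n
    k+k≤n = subst (_≤ n) (cong (k +_) (ℕₚ.+-identityʳ k)) 2k≤n

    +k<n : ∀ {a} → a < k → a + k < n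
    +k<n a<k = ℕₚ.<-≤-trans (ℕₚ.+-monoˡ-< k a<k) k+k≤n

  edges-matching : edges (matching n k) ≡ k
  edges-matching = trans (edges-underlyingGraph n (matchingArc k) (matchingArc-asym k))
                         (trans (sum-cong-≗ {n} row) (∑-𝟙-< (ℕₚ.≤-trans (ℕₚ.m≤m+n k k) k+k≤n)))
    where
    row : ∀ v → ∑[ u < n ] 𝟙 (matchingArc k (toℕ v) (toℕ u)) ≡ 𝟙 (toℕ v <ᵇ k)
    row v with T? (toℕ v <ᵇ k)
    ... | yes v<k rewrite T⇒≡true v<k = ∑-𝟙-≡ (+k<n (ℕₚ.<ᵇ⇒< _ _ v<k))
    ... | no v≮k rewrite ¬T⇒≡false v≮k = sum-replicate-zero n

  matching-covers : ∀ v → T (toℕ v <ᵇ 2 * k) → 0 < degree (matching n k) v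
  matching-covers v v<2k with toℕ v ℕₚ.<? k
  ... | yes v<k = adj⇒0<degree (matching n k) v partner
    (arc⇒adj n (matchingArc k) (matchingArc-asym k) v partner (inj₁ (matchingArc⁺ v<k (Fin.toℕ-fromℕ< _))))
    where partner = fromℕ< (+k<n v<k)
  ... | no v≮k = adj⇒0<degree (matching n k) v partner
    (arc⇒adj n (matchingArc k) (matchingArc-asym k) v partner
      (inj₂ (subst (λ a → T (matchingArc k a (toℕ v))) (≡.sym (Fin.toℕ-fromℕ< _))
                   (matchingArc⁺ v∸k<k (≡.sym (ℕₚ.m∸n+n≡m k≤v))))))
    where
    k≤v : k ≤ toℕ v
    k≤v = ℕₚ.≮⇒≥ v≮k
    k≤n : k ≤ n
    k≤n = ℕₚ.≤-trans (ℕₚ.m≤m+n k k) k+k≤n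
    v∸k<k : toℕ v ∸ k < k
    v∸k<k = ℕₚ.<-≤-trans (ℕₚ.∸-monoˡ-< (ℕₚ.<ᵇ⇒< _ _ v<2k) k≤v)
                         (ℕₚ.≤-reflexive (trans (ℕₚ.m+n∸m≡n k (k + 0)) (ℕₚ.+-identityʳ k)))
    partner = fromℕ< (ℕₚ.<-≤-trans v∸k<k k≤n)

leaf : ℕ → ℕ → Bool
leaf k b = (0 <ᵇ b) ∧ (b <ᵇ suc k)

starArc : ℕ → ℕ → ℕ → Bool
starArc k a b = (a ≡ᵇ 0) ∧ leaf k b

starArc-asym : ∀ k a b → T (starArc k a b) → ¬ T (starArc k b a)
starArc-asym k zero    zero    ()
starArc-asym k zero    (suc b) _ ()
starArc-asym k (suc a) b       ()

star : ∀ n k → Graph n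
star n k = underlyingGraph n (starArc k) (starArc-asym k)

leaves : ∀ n k → Subset n
leaves n k = Vec.tabulate (leaf k ∘ toℕ)

module _ {n k : ℕ} (k≤n : k ≤ n) where

  ∑-leaf : ∑[ u < suc n ] 𝟙 (leaf k (toℕ u)) ≡ k
  ∑-leaf = ∑-𝟙-< k≤n

  edges-star : edges (star (suc n) k) ≡ k
  edges-star = begin
    edges (star (suc n) k)
      ≡⟨ edges-underlyingGraph (suc n) (starArc k) (starArc-asym k) ⟩
    ∑[ u < suc n ] 𝟙 (leaf k (toℕ u)) + ∑[ v < n ] ∑[ u < suc n ] 0
      ≡⟨ cong₂ _+_ ∑-leaf (trans (sum-cong-≗ {n} (λ _ → sum-replicate-zero (suc n)))
                                 (sum-replicate-zero n)) ⟩
    k + 0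
      ≡⟨ ℕₚ.+-identityʳ k ⟩
    k ∎
    where open ≡-Reasoning

  ∣leaves∣ : ∣ leaves (suc n) k ∣ ≡ k
  ∣leaves∣ = trans (∣S∣≡∑ (leaves (suc n) k))
                   (trans (sum-cong-≗ {suc n} (cong 𝟙 ∘ Vecₚ.lookup∘tabulate (leaf k ∘ toℕ))) ∑-leaf)

  leaves-¬isDominating : ¬ T (isDominating (complement (star (suc n) k)) (leaves (suc n) k))
  leaves-¬isDominating dom with isDominating⁻ (complement (star (suc n) k)) (leaves (suc n) k) dom fzero
  ... | inj₁ ()
  ... | inj₂ (u , u∈leaves , u≁0) = proj₂ (complement⁻ (star (suc n) k) u fzero u≁0)
    (arc⇒adj (suc n) (starArc k) (starArc-asym k) u fzero
      (inj₂ (subst T (Vecₚ.lookup∘tabulate (leaf k ∘ toℕ) u) u∈leaves)))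

complement-matching-beats : ∀ {n k} (H : Graph (suc n)) → 2 * k ≤ suc n → edges (complement H) ≡ k →
                            ∀ w → 2 ≤ degree (complement H) w →
                            ∃ λ x → 0ℚ ≤ℚ x × D (complement (matching (suc n) k)) x <ℚ D H x
complement-matching-beats {n} {k} H 2k≤n edges-Hᶜ w 2≤deg =
  D<D-for-small-x (complement F) H (ℕₚ.+-cancelʳ-< (2 * k) _ _ (begin-strict
    d (complement F) 1 + 2 * k
      ≡⟨ cong (_+ 2 * k) (trans (d-1≡zeros (complement F)) zeros-F) ⟩
    zeros (degree F) + 2 * k
      ≡⟨ cong (zeros (degree F) +_) (∑-𝟙-< 2k≤n) ⟨
    zeros (degree F) + ∑[ v < suc n ] 𝟙 (toℕ v <ᵇ 2 * k)
      ≤⟨ zeros+count≤n (degree F) (λ v → toℕ v <ᵇ 2 * k) (matching-covers {k = k} 2k≤n) ⟩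
    suc n
      <⟨ n<zeros+∑ (degree Hᶜ) w 2≤deg ⟩
    zeros (degree Hᶜ) + ∑[ v < suc n ] degree Hᶜ v
      ≡⟨ cong₂ _+_ (≡.sym (d-1≡zeros H)) 2k≡∑deg ⟩
    d H 1 + 2 * k ∎))
  where
  open ℕₚ.≤-Reasoning
  F = matching (suc n) k
  Hᶜ = complement H
  zeros-F : zeros (degree (complement (complement F))) ≡ zeros (degree F)
  zeros-F = sum-cong-≗ {suc n} (λ v → cong (λ m → 𝟙 (m ≡ᵇ 0)) (degree-complement-involutive F v))
  2k≡∑deg : ∑[ v < suc n ] degree Hᶜ v ≡ 2 * k
  2k≡∑deg = trans (handshake Hᶜ) (cong (2 *_) edges-Hᶜ)

complement-star-beats : ∀ {n k} (H : Graph (suc n)) → (∀ v → degree (complement H) v ≤ 1) →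
                        2 ≤ k → k ≤ n →
                        ∃ λ x → 0ℚ ≤ℚ x × D (complement (star (suc n) k)) x <ℚ D H x
complement-star-beats {n} {k@(suc p)} H sparse 2≤k k≤n =
  D<D-for-large-x S H p (ℕₚ.m≤n⇒m≤1+n k≤n) dS<dH dS≤dH
  where
  S = complement (star (suc n) k)
  dominates : ∀ {j} → 2 ≤ j → ∀ W → ∣ W ∣ ≡ j → T (isDominating H W)
  dominates 2≤j W ∣W∣≡j = isDominating-sparse-complement H sparse W (subst (2 ≤_) (≡.sym ∣W∣≡j) 2≤j)
  dS<dH : d S k < d H k
  dS<dH = d-mono-< S H k (λ W ∣W∣≡k _ → dominates 2≤k W ∣W∣≡k) (leaves (suc n) k) (∣leaves∣ k≤n)
                   (leaves-¬isDominating k≤n) (dominates 2≤k (leaves (suc n) k) (∣leaves∣ k≤n))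
  dS≤dH : ∀ j → k < j → d S j ≤ d H j
  dS≤dH j k<j = d-mono S H j (λ W ∣W∣≡j _ → dominates (ℕₚ.≤-trans 2≤k (ℕₚ.<⇒≤ k<j)) W ∣W∣≡j)

theorem3p2 : (n k m : ℕ) → 7 ≤ n → 2 ≤ k → 2 * k ≤ n → m ≡ n C 2 ∸ k →
    ¬ ∃ (λ (H : Graph n) → LeastOptimal n m H)
theorem3p2 zero    _ _ () _ _ _ _
theorem3p2 (suc n) k _ 7≤n 2≤k@(s≤s _) 2k≤n refl (H , edges-H , optimal) =
  refute (any? (λ v → 2 ℕₚ.≤? degree (complement H) v))
  where
  k≤n : k ≤ n
  k≤n = ℕₚ.≤-pred (ℕₚ.<-≤-trans (ℕₚ.m<m+n k (s≤s z≤n)) 2k≤n)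

  k≤C : k ≤ suc n C 2
  k≤C = ℕₚ.≤-trans (ℕₚ.m≤n⇒m≤1+n k≤n) (n≤nC2 (ℕₚ.≤-trans (ℕₚ.m≤m+n 3 4) 7≤n))

  edges-Hᶜ : edges (complement H) ≡ k
  edges-Hᶜ = trans (edges-complement H) (trans (cong (suc n C 2 ∸_) edges-H) (ℕₚ.m∸[m∸n]≡n k≤C))

  beaten : ∀ F → edges F ≡ k → (∃ λ x → 0ℚ ≤ℚ x × D (complement F) x <ℚ D H x) → ⊥
  beaten F edges-F (x , 0≤x , Fᶜ<H) = ℚₚ.<-irrefl refl (ℚₚ.<-≤-trans Fᶜ<H
    (optimal (complement F) (trans (edges-complement F) (cong (suc n C 2 ∸_) edges-F)) x 0≤x))

  refute : Dec (∃ λ v → 2 ≤ degree (complement H) v) → ⊥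
  refute (yes (w , 2≤deg)) = beaten (matching (suc n) k) (edges-matching 2k≤n)
    (complement-matching-beats H 2k≤n edges-Hᶜ w 2≤deg)
  refute (no ¬dense) = beaten (star (suc n) k) (edges-star k≤n)
    (complement-star-beats H (λ v → ℕₚ.≤-pred (ℕₚ.≰⇒> (¬dense ∘ (v ,_)))) 2≤k k≤n)
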